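{- Let $p=(12,\{(0,0),(0,2),(1,0),(1,1),(1,2)\})$. A permutation $\pi\in S_n$ avoids $p$ if and only if for every ascent $\pi_i<\pi_{i+1}$ there is an index $k<i$ with $\pi_k<\pi_i$ (so $\pi_k\pi_i\pi_{i+1}$ is a $123$ pattern whose $23$ is the ascent) or with $\pi_k>\pi_{i+1}$ (so $\pi_k\pi_i\pi_{i+1}$ is a $312$ pattern whose $12$ is the ascent), or both. Writing $a_n=|S_n(p)|$, we have $a_n=n\,a_{n-1}-a_{n-2}$ for $n\ge1$ with $a_{ -1}=0$, $a_0=1$.
   Context: $S_n$ is the set of permutations of $\{1,\dots,n\}$, written $\pi=\pi_1\cdots\pi_n$; an ascent is an index $i$ with $\pi_i<\pi_{i+1}$. A mesh pattern $(12,R)$ of length 2 has $R\subseteq\{0,1,2\}^2$ (shaded boxes). A permutation $\pi\in S_n$ contains $(12,R)$ if there exist indices $i<j$ with $\pi_i<\pi_j$ such that, with $p_0=0,p_1=i,p_2=j,p_3=n+1$ and $v_0=0,v_1=\pi_i,v_2=\pi_j,v_3=n+1$, for every $(a,b)\in R$ there is no index $x$ with $p_a<x<p_{a+1}$ and $v_b<\pi_x<v_{b+1}$. Otherwise $\pi$ avoids it; $S_n(p)$ is the set of avoiders in $S_n$. -}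

module Defs where

open import Data.Nat using (ℕ; zero; suc)
import Data.Nat as ℕ
open import Data.Fin using (Fin; zero; suc; toℕ; inject₁; _<_)
open import Data.Vec using (Vec; lookup)
open import Data.Product using (_×_; _,_; ∃; ∃-syntax)
open import Data.Sum using (_⊎_)
open import Data.List using (List; []; _∷_)
open import Data.List.Membership.Propositional using (_∈_)
open import Relation.Nullary using (¬_)
open import Relation.Binary.PropositionalEquality using (_≡_)

-- A permutation π ∈ S_n is represented by its one-line notation as a
-- vector of length n with entries in Fin n (entry k stands for k+1, index i
-- for position i+1), required to be injective (hence bijective).
IsPerm : ∀ {n} → Vec (Fin n) n → Set
IsPerm v = ∀ i j → lookup v i ≡ lookup v j → i ≡ j

-- A mesh pattern (12, R): R is a set (list) of shaded boxes (a , b), a,b ∈ {0,1,2}.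
Mesh12 : Set
Mesh12 = List (Fin 3 × Fin 3)

pos : ∀ {n} → Fin n → ℕ
pos x = suc (toℕ x)

val : ∀ {n} → Vec (Fin n) n → Fin n → ℕ
val v x = suc (toℕ (lookup v x))

pbound : ∀ {n} → Fin n → Fin n → Fin 4 → ℕ
pbound i j zero = 0
pbound i j (suc zero) = pos i
pbound i j (suc (suc zero)) = pos j
pbound {n} i j (suc (suc (suc zero))) = suc n

vbound : ∀ {n} → Vec (Fin n) n → Fin n → Fin n → Fin 4 → ℕ
vbound v i j zero = 0
vbound v i j (suc zero) = val v i
vbound v i j (suc (suc zero)) = val v j
vbound {n} v i j (suc (suc (suc zero))) = suc n

BoxEmpty : ∀ {n} → Vec (Fin n) n → Fin n → Fin n → Fin 3 × Fin 3 → Set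
BoxEmpty {n} v i j (a , b) =
  ¬ (∃[ x ] ((pbound i j (inject₁ a) ℕ.< pos x × pos x ℕ.< pbound i j (suc a))
            × (vbound v i j (inject₁ b) ℕ.< val v x × val v x ℕ.< vbound v i j (suc b))))

Contains : ∀ {n} → Vec (Fin n) n → Mesh12 → Set
Contains v R =
  ∃[ i ] ∃[ j ] (i < j × lookup v i < lookup v j
                 × (∀ {box} → box ∈ R → BoxEmpty v i j box))

Avoids : ∀ {n} → Vec (Fin n) n → Mesh12 → Set
Avoids v R = ¬ Contains v R

f0 f1 f2 : Fin 3
f0 = zero
f1 = suc zero
f2 = suc (suc zero)

p : Mesh12
p = (f0 , f0) ∷ (f0 , f2) ∷ (f1 , f0) ∷ (f1 , f1) ∷ (f1 , f2) ∷ []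

AscentCondition : ∀ {n} → Vec (Fin n) n → Set
AscentCondition v =
  ∀ i j → toℕ j ≡ suc (toℕ i) → lookup v i < lookup v j →
  ∃[ k ] (k < i × (lookup v k < lookup v i ⊎ lookup v j < lookup v k))

module Submission where

open import Defs
open import Data.Nat using (ℕ; zero; suc; _+_; _*_; z<s; s<s)
import Data.Nat as ℕ
import Data.Nat.Properties as ℕ
open import Data.Fin using (Fin; zero; suc; toℕ; fromℕ; fromℕ<; inject₁; punchIn; punchOut; _<_)
open import Data.Fin.Properties
  using (any?; _<?_; _≟_; <-cmp; <-irrefl; toℕ<n; toℕ-fromℕ; toℕ-fromℕ<; toℕ-inject₁; toℕ-injective;
         ≤fromℕ; ≤∧≢⇒<; fromℕ≢inject₁; inject₁-injective; pigeonhole; 0↔⊥; *↔×; +↔⊎;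
         punchIn-injective; punchInᵢ≢i; punchIn-mono-≤; punchIn-cancel-≤;
         punchIn-punchOut; punchOut-punchIn; punchOut-injective)
open import Data.Fin.Relation.Unary.Top using (view; ‵fromℕ; ‵inject₁)
open import Data.Fin.Permutation using (↔⇒≡)
open import Data.Vec using (Vec; []; _∷_; lookup; map; tabulate; _∷ʳ_)
open import Data.Vec.Properties using (lookup-map; lookup∘tabulate; tabulate∘lookup; tabulate-cong)
open import Data.Product using (_×_; Σ; Σ-syntax; ∃-syntax; _,_; proj₁; proj₂)
open import Data.Product.Function.NonDependent.Propositional using (_×-↔_)
open import Data.Sum using (_⊎_; inj₁; inj₂; [_,_]′)
import Data.Sum as Sum
open import Data.Sum.Function.Propositional using (_⊎-↔_)
open import Data.Empty using (⊥; ⊥-elim; ⊥-elim-irr)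
open import Data.List.Relation.Unary.Any using (here; there)
open import Data.List.Membership.Propositional using (_∈_)
open import Data.Refinement using (Refinement-syntax; _,_; value; proof; refine; value-injective)
open import Data.Irrelevant using ([_])
open import Function.Base using (_∘_)
open import Function.Bundles using (_⇔_; _↔_; mk⇔; mk↔ₛ′; Inverse; Equivalence)
open import Function.Properties.Inverse using (↔-refl; ↔-sym; ↔-trans)
open import Relation.Nullary using (¬_; ¬?; Dec; yes; no)
open import Relation.Nullary.Decidable using (_×-dec_; _⊎-dec_; recompute)
open import Relation.Unary using (Decidable)
open import Relation.Binary using (tri<; tri≈; tri>)
open import Relation.Binary.PropositionalEquality
  using (_≡_; _≢_; refl; sym; trans; cong; cong₂; subst; subst₂; module ≡-Reasoning)

-- The pattern only has an occurrence (i, j) when j = i + 1 (column 1 is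
-- shaded), and then exactly when no earlier entry lies below π_i or above π_j
-- (boxes (0,0) and (0,2)); this is the ascent condition. For the count, call a
-- permutation good if it satisfies the ascent condition. Deleting the last
-- entry c of a good π ∈ S_{n+1} and standardising gives a good σ ∈ S_n, and
-- conversely appending c to a good σ can only break the new ascent π_n < c,
-- which happens exactly when σ ends in its minimum and c is the new maximum.
-- These "blocked" pairs (σ, c) are in bijection with the good permutations of
-- S_{n-1} (delete the final 1 of σ), hence a_{n+1} = (n+1) a_n - a_{n-1}.

private variable
  n : ℕ
  A B : Set

pattern shaded₀₀ = here refl
pattern shaded₀₂ = there (here refl)
pattern shaded₁₀ = there (there (here refl))
pattern shaded₁₁ = there (there (there (here refl)))
pattern shaded₁₂ = there (there (there (there (here refl))))

HasWitness : Vec (Fin n) n → Fin n → Fin n → Set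
HasWitness v i j = ∃[ k ] (k < i × (lookup v k < lookup v i ⊎ lookup v j < lookup v k))

hasWitness? : (v : Vec (Fin n) n) (i j : Fin n) → Dec (HasWitness v i j)
hasWitness? v i j =
  any? λ k → k <? i ×-dec (lookup v k <? lookup v i ⊎-dec lookup v j <? lookup v k)

no-position-between : ∀ {i j x : Fin n} → toℕ j ≡ suc (toℕ i) → ¬ (pos i ℕ.< pos x × pos x ℕ.< pos j)
no-position-between j≡1+i (s<s i<x , s<s x<j) rewrite j≡1+i =
  ℕ.<-irrefl refl (ℕ.<-≤-trans i<x (ℕ.s≤s⁻¹ x<j))

avoids⇒ascentCondition : (v : Vec (Fin n) n) → Avoids v p → AscentCondition v
avoids⇒ascentCondition v avoids i j j≡1+i vi<vj with hasWitness? v i j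
... | yes witness = witness
... | no ¬witness = ⊥-elim (avoids (i , j , i<j , vi<vj , empty))
  where
  i<j : i < j
  i<j = subst (toℕ i ℕ.<_) (sym j≡1+i) (ℕ.n<1+n _)
  empty : ∀ {box} → box ∈ p → BoxEmpty v i j box
  empty shaded₀₀ (k , (_ , s<s k<i) , (_ , s<s vk<vi)) = ¬witness (k , k<i , inj₁ vk<vi)
  empty shaded₀₂ (k , (_ , s<s k<i) , (s<s vj<vk , _)) = ¬witness (k , k<i , inj₂ vj<vk)
  empty shaded₁₀ (_ , between , _) = no-position-between j≡1+i between
  empty shaded₁₁ (_ , between , _) = no-position-between j≡1+i between
  empty shaded₁₂ (_ , between , _) = no-position-between j≡1+i between
  empty (there (there (there (there (there ())))))

column₁-occupied : (v : Vec (Fin n) n) → IsPerm v → ∀ {i j} x → pos i ℕ.< pos x → pos x ℕ.< pos j →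
                   (∀ {box} → box ∈ p → BoxEmpty v i j box) → ⊥
column₁-occupied v inj {i} {j} x i<x x<j empty with <-cmp (lookup v x) (lookup v i)
... | tri< vx<vi _ _ = empty shaded₁₀ (x , (i<x , x<j) , (z<s , s<s vx<vi))
... | tri≈ _ vx≡vi _ = ℕ.<-irrefl (cong (suc ∘ toℕ) (sym (inj x i vx≡vi))) i<x
... | tri> _ _ vi<vx with <-cmp (lookup v x) (lookup v j)
...   | tri< vx<vj _ _ = empty shaded₁₁ (x , (i<x , x<j) , (s<s vi<vx , s<s vx<vj))
...   | tri≈ _ vx≡vj _ = ℕ.<-irrefl (cong (suc ∘ toℕ) (inj x j vx≡vj)) x<j
...   | tri> _ _ vj<vx = empty shaded₁₂ (x , (i<x , x<j) , (s<s vj<vx , s<s (toℕ<n _)))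

ascentCondition⇒avoids : (v : Vec (Fin n) n) → IsPerm v → AscentCondition v → Avoids v p
ascentCondition⇒avoids v inj ac (i , j , i<j , vi<vj , empty) with toℕ j ℕ.≟ suc (toℕ i)
... | yes j≡1+i with ac i j j≡1+i vi<vj
...   | k , k<i , inj₁ vk<vi = empty shaded₀₀ (k , (z<s , s<s k<i) , (z<s , s<s vk<vi))
...   | k , k<i , inj₂ vj<vk = empty shaded₀₂ (k , (z<s , s<s k<i) , (s<s vj<vk , s<s (toℕ<n _)))
ascentCondition⇒avoids {n} v inj ac (i , j , i<j , vi<vj , empty) | no j≢1+i =
  column₁-occupied v inj i+1 (s<s i<i+1) (s<s i+1<j) empty
  where
  1+i<j : suc (toℕ i) ℕ.< toℕ j
  1+i<j = ℕ.≤∧≢⇒< i<j (j≢1+i ∘ sym)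
  i+1 : Fin n
  i+1 = fromℕ< (ℕ.<-trans 1+i<j (toℕ<n j))
  i+1≡1+i : toℕ i+1 ≡ suc (toℕ i)
  i+1≡1+i = toℕ-fromℕ< _
  i<i+1 : toℕ i ℕ.< toℕ i+1
  i<i+1 = subst (toℕ i ℕ.<_) (sym i+1≡1+i) (ℕ.n<1+n _)
  i+1<j : toℕ i+1 ℕ.< toℕ j
  i+1<j = subst (ℕ._< toℕ j) (sym i+1≡1+i) 1+i<j

avoids⇔ascentCondition : (v : Vec (Fin n) n) → IsPerm v → Avoids v p ⇔ AscentCondition v
avoids⇔ascentCondition v inj = mk⇔ (avoids⇒ascentCondition v) (ascentCondition⇒avoids v inj)

lookup-extensionality : (u w : Vec A n) → (∀ i → lookup u i ≡ lookup w i) → u ≡ w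
lookup-extensionality u w eq =
  trans (sym (tabulate∘lookup u)) (trans (tabulate-cong eq) (tabulate∘lookup w))

lookup-∷ʳ-inject₁ : (xs : Vec A n) (x : A) (i : Fin n) → lookup (xs ∷ʳ x) (inject₁ i) ≡ lookup xs i
lookup-∷ʳ-inject₁ (y ∷ xs) x zero = refl
lookup-∷ʳ-inject₁ (y ∷ xs) x (suc i) = lookup-∷ʳ-inject₁ xs x i

lookup-∷ʳ-fromℕ : (xs : Vec A n) (x : A) → lookup (xs ∷ʳ x) (fromℕ n) ≡ x
lookup-∷ʳ-fromℕ [] x = refl
lookup-∷ʳ-fromℕ (y ∷ xs) x = lookup-∷ʳ-fromℕ xs x

fromℕ-maximal : (y : Fin (suc n)) → ¬ (fromℕ n < y)
fromℕ-maximal y max<y = ℕ.<⇒≱ max<y (≤fromℕ y)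

below-fromℕ : {y : Fin (suc n)} → y ≢ fromℕ n → y < fromℕ n
below-fromℕ {y = y} y≢max = ≤∧≢⇒< (≤fromℕ y) y≢max

inject₁-mono-< : {i j : Fin n} → i < j → inject₁ i < inject₁ j
inject₁-mono-< {i = i} {j} = subst₂ ℕ._<_ (sym (toℕ-inject₁ i)) (sym (toℕ-inject₁ j))

inject₁-cancel-< : {i j : Fin n} → inject₁ i < inject₁ j → i < j
inject₁-cancel-< {i = i} {j} = subst₂ ℕ._<_ (toℕ-inject₁ i) (toℕ-inject₁ j)

inject₁-adjacent : {i j : Fin n} → toℕ j ≡ suc (toℕ i) → toℕ (inject₁ j) ≡ suc (toℕ (inject₁ i))
inject₁-adjacent {i = i} {j} = subst₂ (λ a b → a ≡ suc b) (sym (toℕ-inject₁ j)) (sym (toℕ-inject₁ i))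

inject₁-adjacent⁻¹ : {i j : Fin n} → toℕ (inject₁ j) ≡ suc (toℕ (inject₁ i)) →
                     toℕ j ≡ suc (toℕ i)
inject₁-adjacent⁻¹ {i = i} {j} = subst₂ (λ a b → a ≡ suc b) (toℕ-inject₁ j) (toℕ-inject₁ i)

punchIn-mono-< : (c : Fin (suc n)) {x y : Fin n} → x < y → punchIn c x < punchIn c y
punchIn-mono-< c {x} {y} x<y = ≤∧≢⇒< (punchIn-mono-≤ c x y (ℕ.<⇒≤ x<y))
  (λ eq → <-irrefl (punchIn-injective c x y eq) x<y)

punchIn-cancel-< : (c : Fin (suc n)) {x y : Fin n} → punchIn c x < punchIn c y → x < y
punchIn-cancel-< c {x} {y} lt = ≤∧≢⇒< (punchIn-cancel-≤ c x y (ℕ.<⇒≤ lt))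
  (λ eq → <-irrefl (cong (punchIn c) eq) lt)

-- A variant of punchOut whose proof is irrelevant, so that it can be used
-- under the irrelevant proofs carried by refinements.
punchOut′ : (i j : Fin (suc n)) → .(i ≢ j) → Fin n
punchOut′ i j i≢j with i ≟ j
... | yes i≡j = ⊥-elim-irr (i≢j i≡j)
... | no i≢j′ = punchOut i≢j′

punchIn-punchOut′ : (i j : Fin (suc n)) .(i≢j : i ≢ j) → punchIn i (punchOut′ i j i≢j) ≡ j
punchIn-punchOut′ i j i≢j with i ≟ j
... | yes i≡j = ⊥-elim-irr (i≢j i≡j)
... | no i≢j′ = punchIn-punchOut i≢j′

punchOut′-punchIn : (i : Fin (suc n)) (x : Fin n) .(i≢j : i ≢ punchIn i x) →
                    punchOut′ i (punchIn i x) i≢j ≡ x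
punchOut′-punchIn i x i≢j with i ≟ punchIn i x
... | yes i≡j = ⊥-elim-irr (i≢j i≡j)
... | no i≢j′ = punchOut-punchIn i

punchOut′-cong : {i i′ j j′ : Fin (suc n)} .(i≢j : i ≢ j) .(i′≢j′ : i′ ≢ j′) →
                 i ≡ i′ → j ≡ j′ → punchOut′ i j i≢j ≡ punchOut′ i′ j′ i′≢j′
punchOut′-cong _ _ refl refl = refl

isPerm⇒surjective : (v : Vec (Fin n) n) → IsPerm v → ∀ y → ∃[ k ] lookup v k ≡ y
isPerm⇒surjective {suc n} v inj y with any? (λ k → lookup v k ≟ y)
... | yes hit = hit
... | no miss with pigeonhole (ℕ.n<1+n n) (λ k → punchOut {i = y} {j = lookup v k} (miss ∘ (k ,_) ∘ sym))
...   | k , l , k<l , eq = ⊥-elim (<-irrefl (inj k l (punchOut-injective {i = y} _ _ eq)) k<l)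

refinement-transport : (e : A ↔ B) {P : A → Set} → [ a ∈ A ∣ P a ] ↔ [ b ∈ B ∣ P (Inverse.from e b) ]
refinement-transport {A} {B} e {P} = mk↔ₛ′ to from to∘from from∘to
  where
  open Inverse e using (strictlyInverseˡ; strictlyInverseʳ) renaming (to to toₑ; from to fromₑ)
  to : [ a ∈ A ∣ P a ] → [ b ∈ B ∣ P (fromₑ b) ]
  to (a , [ pa ]) = toₑ a , [ subst P (sym (strictlyInverseʳ a)) pa ]
  from : [ b ∈ B ∣ P (fromₑ b) ] → [ a ∈ A ∣ P a ]
  from (b , pb) = fromₑ b , pb
  to∘from : ∀ b → to (from b) ≡ b
  to∘from (b , _) = value-injective (strictlyInverseˡ b)
  from∘to : ∀ a → from (to a) ≡ a
  from∘to (a , _) = value-injective (strictlyInverseʳ a)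

refinement-⇔ : {P Q : A → Set} → (∀ {a} → P a ⇔ Q a) → [ a ∈ A ∣ P a ] ↔ [ a ∈ A ∣ Q a ]
refinement-⇔ P⇔Q =
  mk↔ₛ′ (refine (Equivalence.to P⇔Q)) (refine (Equivalence.from P⇔Q)) (λ _ → refl) (λ _ → refl)

partition-↔ : {P : A → Set} → Decidable P → A ↔ ([ a ∈ A ∣ P a ] ⊎ [ a ∈ A ∣ ¬ P a ])
partition-↔ {A} {P} P? = mk↔ₛ′ to [ value , value ]′ to∘from from∘to
  where
  to : A → [ a ∈ A ∣ P a ] ⊎ [ a ∈ A ∣ ¬ P a ]
  to a with P? a
  ... | yes pa = inj₁ (a , [ pa ])
  ... | no ¬pa = inj₂ (a , [ ¬pa ])
  to∘from : ∀ x → to ([ value , value ]′ x) ≡ x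
  to∘from (inj₁ (a , [ pa ])) with P? a
  ... | yes _ = refl
  ... | no ¬pa = ⊥-elim-irr (¬pa pa)
  to∘from (inj₂ (a , [ ¬pa ])) with P? a
  ... | yes pa = ⊥-elim-irr (¬pa pa)
  ... | no _ = refl
  from∘to : ∀ a → [ value , value ]′ (to a) ≡ a
  from∘to a with P? a
  ... | yes _ = refl
  ... | no _ = refl

module _ {N : ℕ} {Q : Fin (suc N) → Set} {k : ℕ} (tail↔ : [ y ∈ Fin N ∣ Q (suc y) ] ↔ Fin k) where
  open Inverse tail↔ using (strictlyInverseˡ; strictlyInverseʳ) renaming (to to toₜ; from to fromₜ)

  subset-suc-yes : Q zero → [ y ∈ Fin (suc N) ∣ Q y ] ↔ Fin (suc k)
  subset-suc-yes q = mk↔ₛ′ to from to∘from from∘to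
    where
    to : [ y ∈ Fin (suc N) ∣ Q y ] → Fin (suc k)
    to (zero , _) = zero
    to (suc y , qy) = suc (toₜ (y , qy))
    from : Fin (suc k) → [ y ∈ Fin (suc N) ∣ Q y ]
    from zero = zero , [ q ]
    from (suc z) = suc (value (fromₜ z)) , proof (fromₜ z)
    to∘from : ∀ z → to (from z) ≡ z
    to∘from zero = refl
    to∘from (suc z) = cong suc (strictlyInverseˡ z)
    from∘to : ∀ y → from (to y) ≡ y
    from∘to (zero , _) = refl
    from∘to (suc y , qy) = value-injective (cong (suc ∘ value) (strictlyInverseʳ (y , qy)))

  subset-suc-no : ¬ Q zero → [ y ∈ Fin (suc N) ∣ Q y ] ↔ Fin k
  subset-suc-no ¬q = mk↔ₛ′ to from strictlyInverseˡ from∘to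
    where
    to : [ y ∈ Fin (suc N) ∣ Q y ] → Fin k
    to (zero , [ q ]) = ⊥-elim-irr (¬q q)
    to (suc y , qy) = toₜ (y , qy)
    from : Fin k → [ y ∈ Fin (suc N) ∣ Q y ]
    from z = suc (value (fromₜ z)) , proof (fromₜ z)
    from∘to : ∀ y → from (to y) ≡ y
    from∘to (zero , [ q ]) = ⊥-elim-irr (¬q q)
    from∘to (suc y , qy) = value-injective (cong (suc ∘ value) (strictlyInverseʳ (y , qy)))

subset↔Fin : ∀ {N} {Q : Fin N → Set} → Decidable Q → Σ[ k ∈ ℕ ] ([ y ∈ Fin N ∣ Q y ] ↔ Fin k)
subset↔Fin {zero} Q? = 0 , mk↔ₛ′ (λ { (() , _) }) (λ ()) (λ ()) (λ { (() , _) })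
subset↔Fin {suc N} Q? with subset↔Fin (Q? ∘ suc) | Q? zero
... | k , tail↔ | yes q = suc k , subset-suc-yes tail↔ q
... | k , tail↔ | no ¬q = k , subset-suc-no tail↔ ¬q

record FiniteSplit (A : Set) (P : A → Set) (N : ℕ) : Set where
  field
    #in #out : ℕ
    in↔ : [ a ∈ A ∣ P a ] ↔ Fin #in
    out↔ : [ a ∈ A ∣ ¬ P a ] ↔ Fin #out
    #in+#out≡N : #in + #out ≡ N

finiteSplit : ∀ {N} {P : A → Set} → A ↔ Fin N → Decidable P → FiniteSplit A P N
finiteSplit {A} {N} {P} A↔Fin P? = record
  { in↔ = ↔-trans (refinement-transport A↔Fin) (proj₂ inside)
  ; out↔ = ↔-trans (refinement-transport A↔Fin) (proj₂ outside)
  ; #in+#out≡N = ↔⇒≡ (↔-trans +↔⊎ (↔-trans (↔-sym (proj₂ inside) ⊎-↔ ↔-sym (proj₂ outside))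
                                           (↔-sym (partition-↔ P′?))))
  }
  where
  P′ : Fin N → Set
  P′ = P ∘ Inverse.from A↔Fin
  P′? : Decidable P′
  P′? = P? ∘ Inverse.from A↔Fin
  inside : Σ[ k ∈ ℕ ] ([ y ∈ Fin N ∣ P′ y ] ↔ Fin k)
  inside = subset↔Fin P′?
  outside : Σ[ k ∈ ℕ ] ([ y ∈ Fin N ∣ ¬ P′ y ] ↔ Fin k)
  outside = subset↔Fin (¬? ∘ P′?)

lastEntry : Vec (Fin (suc n)) (suc n) → Fin (suc n)
lastEntry {n} π = lookup π (fromℕ n)

extend : Vec (Fin n) n → Fin (suc n) → Vec (Fin (suc n)) (suc n)
extend σ c = map (punchIn c) σ ∷ʳ c

lookup-extend-inject₁ : (σ : Vec (Fin n) n) (c : Fin (suc n)) (k : Fin n) →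
                        lookup (extend σ c) (inject₁ k) ≡ punchIn c (lookup σ k)
lookup-extend-inject₁ σ c k = trans (lookup-∷ʳ-inject₁ (map (punchIn c) σ) c k) (lookup-map k (punchIn c) σ)

lastEntry-extend : (σ : Vec (Fin n) n) (c : Fin (suc n)) → lastEntry (extend σ c) ≡ c
lastEntry-extend σ c = lookup-∷ʳ-fromℕ (map (punchIn c) σ) c

extend-mono-< : (σ : Vec (Fin n) n) (c : Fin (suc n)) {k l : Fin n} → lookup σ k < lookup σ l →
                lookup (extend σ c) (inject₁ k) < lookup (extend σ c) (inject₁ l)
extend-mono-< σ c {k} {l} lt =
  subst₂ _<_ (sym (lookup-extend-inject₁ σ c k)) (sym (lookup-extend-inject₁ σ c l)) (punchIn-mono-< c lt)

extend-cancel-< : (σ : Vec (Fin n) n) (c : Fin (suc n)) {k l : Fin n} →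
                  lookup (extend σ c) (inject₁ k) < lookup (extend σ c) (inject₁ l) → lookup σ k < lookup σ l
extend-cancel-< σ c {k} {l} lt =
  punchIn-cancel-< c (subst₂ _<_ (lookup-extend-inject₁ σ c k) (lookup-extend-inject₁ σ c l) lt)

lastEntry≢ : (π : Vec (Fin (suc n)) (suc n)) → IsPerm π → (k : Fin n) →
             lastEntry π ≢ lookup π (inject₁ k)
lastEntry≢ π inj k eq = fromℕ≢inject₁ (inj _ _ eq)

removeLast : (π : Vec (Fin (suc n)) (suc n)) → .(IsPerm π) → Vec (Fin n) n
removeLast π inj = tabulate λ k → punchOut′ (lastEntry π) (lookup π (inject₁ k)) (lastEntry≢ π inj k)

lookup-removeLast : (π : Vec (Fin (suc n)) (suc n)) .(inj : IsPerm π) (k : Fin n) →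
                    lookup (removeLast π inj) k ≡
                    punchOut′ (lastEntry π) (lookup π (inject₁ k)) (lastEntry≢ π inj k)
lookup-removeLast π inj k = lookup∘tabulate _ k

extend-removeLast : (π : Vec (Fin (suc n)) (suc n)) .(inj : IsPerm π) →
                    extend (removeLast π inj) (lastEntry π) ≡ π
extend-removeLast π inj = lookup-extensionality _ π entry
  where
  entry : ∀ i → lookup (extend (removeLast π inj) (lastEntry π)) i ≡ lookup π i
  entry i with view i
  ... | ‵fromℕ = lastEntry-extend (removeLast π inj) (lastEntry π)
  ... | ‵inject₁ k = begin
    lookup (extend (removeLast π inj) (lastEntry π)) (inject₁ k)
      ≡⟨ lookup-extend-inject₁ (removeLast π inj) (lastEntry π) k ⟩
    punchIn (lastEntry π) (lookup (removeLast π inj) k)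
      ≡⟨ cong (punchIn (lastEntry π)) (lookup-removeLast π inj k) ⟩
    punchIn (lastEntry π) (punchOut′ (lastEntry π) (lookup π (inject₁ k)) _)
      ≡⟨ punchIn-punchOut′ _ _ (lastEntry≢ π inj k) ⟩
    lookup π (inject₁ k) ∎
    where open ≡-Reasoning

removeLast-extend : (σ : Vec (Fin n) n) (c : Fin (suc n)) .(inj : IsPerm (extend σ c)) →
                    removeLast (extend σ c) inj ≡ σ
removeLast-extend σ c inj = lookup-extensionality _ σ λ k → begin
  lookup (removeLast (extend σ c) inj) k
    ≡⟨ lookup-removeLast (extend σ c) inj k ⟩
  punchOut′ (lastEntry (extend σ c)) (lookup (extend σ c) (inject₁ k)) _
    ≡⟨ punchOut′-cong (lastEntry≢ (extend σ c) inj k) c≢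
                      (lastEntry-extend σ c) (lookup-extend-inject₁ σ c k) ⟩
  punchOut′ c (punchIn c (lookup σ k)) _
    ≡⟨ punchOut′-punchIn c (lookup σ k) c≢ ⟩
  lookup σ k ∎
  where
  open ≡-Reasoning
  c≢ : ∀ {k} → c ≢ punchIn c (lookup σ k)
  c≢ {k} = punchInᵢ≢i c (lookup σ k) ∘ sym

extend-inject₁≢lastEntry : (σ : Vec (Fin n) n) (c : Fin (suc n)) (k : Fin n) →
                           lookup (extend σ c) (inject₁ k) ≢ lastEntry (extend σ c)
extend-inject₁≢lastEntry σ c k eq = punchInᵢ≢i c (lookup σ k)
  (trans (sym (lookup-extend-inject₁ σ c k)) (trans eq (lastEntry-extend σ c)))

isPerm-extend : (σ : Vec (Fin n) n) (c : Fin (suc n)) → IsPerm σ → IsPerm (extend σ c)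
isPerm-extend σ c inj a b eq with view a | view b
... | ‵fromℕ | ‵fromℕ = refl
... | ‵fromℕ | ‵inject₁ l = ⊥-elim (extend-inject₁≢lastEntry σ c l (sym eq))
... | ‵inject₁ k | ‵fromℕ = ⊥-elim (extend-inject₁≢lastEntry σ c k eq)
... | ‵inject₁ k | ‵inject₁ l = cong inject₁ (inj k l (punchIn-injective c _ _
  (trans (sym (lookup-extend-inject₁ σ c k)) (trans eq (lookup-extend-inject₁ σ c l)))))

isPerm-extend⁻¹ : (σ : Vec (Fin n) n) (c : Fin (suc n)) → IsPerm (extend σ c) → IsPerm σ
isPerm-extend⁻¹ σ c inj k l eq = inject₁-injective (inj _ _
  (trans (lookup-extend-inject₁ σ c k) (trans (cong (punchIn c) eq) (sym (lookup-extend-inject₁ σ c l)))))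

hasWitness-extend : (σ : Vec (Fin n) n) (c : Fin (suc n)) {i j : Fin n} →
                    HasWitness σ i j → HasWitness (extend σ c) (inject₁ i) (inject₁ j)
hasWitness-extend σ c (k , k<i , below-or-above) =
  inject₁ k , inject₁-mono-< k<i , Sum.map (extend-mono-< σ c) (extend-mono-< σ c) below-or-above

hasWitness-extend⁻¹ : (σ : Vec (Fin n) n) (c : Fin (suc n)) {i j : Fin n} →
                      HasWitness (extend σ c) (inject₁ i) (inject₁ j) → HasWitness σ i j
hasWitness-extend⁻¹ σ c {i} (k , k<i , below-or-above) with view k
... | ‵fromℕ = ⊥-elim (fromℕ-maximal (inject₁ i) k<i)
... | ‵inject₁ k′ =
  k′ , inject₁-cancel-< k<i , Sum.map (extend-cancel-< σ c) (extend-cancel-< σ c) below-or-above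

ascentCondition-extend⁻¹ : (σ : Vec (Fin n) n) (c : Fin (suc n)) →
                           AscentCondition (extend σ c) → AscentCondition σ
ascentCondition-extend⁻¹ σ c ac i j j≡1+i σi<σj =
  hasWitness-extend⁻¹ σ c (ac (inject₁ i) (inject₁ j) (inject₁-adjacent j≡1+i) (extend-mono-< σ c σi<σj))

-- Appending c creates a single new ascent, the last one, and it lacks a
-- witness precisely when σ ends in its minimum and c is the new maximum.
Blocked : Vec (Fin n) n → Fin (suc n) → Set
Blocked {zero} σ c = ⊥
Blocked {suc m} σ c = lastEntry σ ≡ zero × c ≡ fromℕ (suc m)

blocked? : (σ : Vec (Fin n) n) (c : Fin (suc n)) → Dec (Blocked σ c)
blocked? {zero} σ c = no λ ()
blocked? {suc m} σ c = (lastEntry σ ≟ zero) ×-dec (c ≟ fromℕ (suc m))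

ascentCondition-extend⇒¬blocked : (σ : Vec (Fin n) n) (c : Fin (suc n)) →
                                  AscentCondition (extend σ c) → ¬ Blocked σ c
ascentCondition-extend⇒¬blocked {suc m} σ c ac (σₘ≡0 , refl) =
  noWitness (ac (inject₁ (fromℕ m)) (fromℕ (suc m)) (cong suc (sym (toℕ-inject₁ (fromℕ m)))) ascent)
  where
  π : Vec (Fin (suc (suc m))) (suc (suc m))
  π = extend σ c
  πₘ≡0 : lookup π (inject₁ (fromℕ m)) ≡ zero
  πₘ≡0 = trans (lookup-extend-inject₁ σ c (fromℕ m)) (cong (punchIn c) σₘ≡0)
  ascent : lookup π (inject₁ (fromℕ m)) < lastEntry π
  ascent = subst₂ _<_ (sym πₘ≡0) (sym (lastEntry-extend σ c)) z<s
  noWitness : ¬ HasWitness π (inject₁ (fromℕ m)) (fromℕ (suc m))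
  noWitness (k , _ , inj₁ πk<πₘ) = ℕ.n≮0 (subst (λ z → lookup π k < z) πₘ≡0 πk<πₘ)
  noWitness (k , _ , inj₂ c<πk) = fromℕ-maximal _ (subst (_< lookup π k) (lastEntry-extend σ c) c<πk)

-- If σ does not end in its minimum, the minimum of σ witnesses the last ascent
-- from below; otherwise c is not the new maximum, and the maximum of π
-- witnesses it from above.
lastAscent-hasWitness′ : ∀ {m} (σ : Vec (Fin (suc m)) (suc m)) (c : Fin (suc (suc m))) →
                         IsPerm σ → ¬ Blocked σ c →
                         lookup (extend σ c) (inject₁ (fromℕ m)) < lastEntry (extend σ c) →
                         HasWitness (extend σ c) (inject₁ (fromℕ m)) (fromℕ (suc m))
lastAscent-hasWitness′ {m} σ c inj unblocked ascent with lastEntry σ ≟ zero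
... | no σₘ≢0 with isPerm⇒surjective σ inj zero
...   | k , σk≡0 = inject₁ k , inject₁-mono-< (below-fromℕ k≢m) , inj₁ (extend-mono-< σ c σk<σₘ)
  where
  k≢m : k ≢ fromℕ m
  k≢m refl = σₘ≢0 σk≡0
  σk<σₘ : lookup σ k < lastEntry σ
  σk<σₘ rewrite σk≡0 = ℕ.n≢0⇒n>0 (σₘ≢0 ∘ toℕ-injective)
lastAscent-hasWitness′ {m} σ c inj unblocked ascent | yes σₘ≡0
  with isPerm⇒surjective (extend σ c) (isPerm-extend σ c inj) (fromℕ (suc m))
... | k , πk≡max with view k
...   | ‵fromℕ = ⊥-elim (unblocked (σₘ≡0 , trans (sym (lastEntry-extend σ c)) πk≡max))
...   | ‵inject₁ k′ = inject₁ k′ , inject₁-mono-< (below-fromℕ k′≢m) , inj₂ c<πk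
  where
  k′≢m : k′ ≢ fromℕ m
  k′≢m refl = fromℕ-maximal _ (subst (_< lastEntry (extend σ c)) πk≡max ascent)
  c<πk : lastEntry (extend σ c) < lookup (extend σ c) (inject₁ k′)
  c<πk = subst₂ _<_ (sym (lastEntry-extend σ c)) (sym πk≡max)
                (below-fromℕ (unblocked ∘ (σₘ≡0 ,_)))

lastAscent-hasWitness : (σ : Vec (Fin n) n) (c : Fin (suc n)) → IsPerm σ → ¬ Blocked σ c →
                        (i : Fin n) →
                        toℕ (fromℕ n) ≡ suc (toℕ (inject₁ i)) →
                        lookup (extend σ c) (inject₁ i) < lastEntry (extend σ c) →
                        HasWitness (extend σ c) (inject₁ i) (fromℕ n)
lastAscent-hasWitness {suc m} σ c inj unblocked i adjacent
  with toℕ-injective {i = fromℕ m} {j = i} (trans (ℕ.suc-injective adjacent) (toℕ-inject₁ i))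
... | refl = lastAscent-hasWitness′ σ c inj unblocked

ascentCondition-extend : (σ : Vec (Fin n) n) (c : Fin (suc n)) → IsPerm σ → AscentCondition σ →
                         ¬ Blocked σ c → AscentCondition (extend σ c)
ascentCondition-extend {n} σ c inj ac unblocked i j j≡1+i πi<πj with view j | view i
... | ‵inject₁ j′ | ‵inject₁ i′ =
  hasWitness-extend σ c (ac i′ j′ (inject₁-adjacent⁻¹ j≡1+i) (extend-cancel-< σ c πi<πj))
... | ‵inject₁ j′ | ‵fromℕ =
  ⊥-elim (ℕ.<-irrefl (trans (sym (toℕ-inject₁ j′)) (trans j≡1+i (cong suc (toℕ-fromℕ n))))
                     (ℕ.<-trans (toℕ<n j′) (ℕ.n<1+n n)))
... | ‵fromℕ | ‵fromℕ = ⊥-elim (ℕ.1+n≢n (sym j≡1+i))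
... | ‵fromℕ | ‵inject₁ i′ = lastAscent-hasWitness σ c inj unblocked i′ j≡1+i πi<πj

IsGood : Vec (Fin n) n → Set
IsGood v = IsPerm v × AscentCondition v

isGood-extend : (σ : Vec (Fin n) n) (c : Fin (suc n)) → IsGood σ → ¬ Blocked σ c → IsGood (extend σ c)
isGood-extend σ c (inj , ac) unblocked = isPerm-extend σ c inj , ascentCondition-extend σ c inj ac unblocked

isGood-extend⁻¹ : (σ : Vec (Fin n) n) (c : Fin (suc n)) → IsGood (extend σ c) → IsGood σ × ¬ Blocked σ c
isGood-extend⁻¹ σ c (inj , ac) =
  (isPerm-extend⁻¹ σ c inj , ascentCondition-extend⁻¹ σ c ac) , ascentCondition-extend⇒¬blocked σ c ac

isGood-removeLast : (π : Vec (Fin (suc n)) (suc n)) (good : IsGood π) →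
                    IsGood (removeLast π (proj₁ good)) × ¬ Blocked (removeLast π (proj₁ good)) (lastEntry π)
isGood-removeLast π good =
  isGood-extend⁻¹ _ (lastEntry π) (subst IsGood (sym (extend-removeLast π (proj₁ good))) good)

¬blocked-zero : (σ : Vec (Fin n) n) → ¬ Blocked σ zero
¬blocked-zero {suc m} σ (_ , ())

Good : ℕ → Set
Good n = [ v ∈ Vec (Fin n) n ∣ IsGood v ]

Extension : ℕ → Set
Extension n = Good n × Fin (suc n)

BlockedExtension : Extension n → Set
BlockedExtension (σ , c) = Blocked (value σ) c

good↔unblocked : Good (suc n) ↔ [ e ∈ Extension n ∣ ¬ BlockedExtension e ]
good↔unblocked {n} = mk↔ₛ′ to from to∘from from∘to
  where
  to : Good (suc n) → [ e ∈ Extension n ∣ ¬ BlockedExtension e ]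
  to (π , [ good ]) =
    ((removeLast π (proj₁ good) , [ proj₁ (isGood-removeLast π good) ]) , lastEntry π) ,
    [ proj₂ (isGood-removeLast π good) ]
  from : [ e ∈ Extension n ∣ ¬ BlockedExtension e ] → Good (suc n)
  from (((σ , [ good ]) , c) , [ unblocked ]) = extend σ c , [ isGood-extend σ c good unblocked ]
  to∘from : ∀ e → to (from e) ≡ e
  to∘from (((σ , [ good ]) , c) , [ unblocked ]) = value-injective (cong₂ _,_
    (value-injective (removeLast-extend σ c (isPerm-extend σ c (proj₁ good))))
    (lastEntry-extend σ c))
  from∘to : ∀ π → from (to π) ≡ π
  from∘to (π , [ good ]) = value-injective (extend-removeLast π (proj₁ good))

Previous : ℕ → Set
Previous zero = ⊥
Previous (suc m) = Good m

blocked↔previous : [ e ∈ Extension n ∣ BlockedExtension e ] ↔ Previous n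
blocked↔previous {zero} = mk↔ₛ′ (λ { (_ , [ () ]) }) (λ ()) (λ ()) (λ { (_ , [ () ]) })
blocked↔previous {suc m} = mk↔ₛ′ to from to∘from from∘to
  where
  to : [ e ∈ Extension (suc m) ∣ BlockedExtension e ] → Good m
  to (((σ , [ good ]) , _) , _) = removeLast σ (proj₁ good) , [ proj₁ (isGood-removeLast σ good) ]
  from : Good m → [ e ∈ Extension (suc m) ∣ BlockedExtension e ]
  from (τ , [ good ]) =
    ((extend τ zero , [ isGood-extend τ zero good (¬blocked-zero τ) ]) , fromℕ (suc m)) ,
    [ lastEntry-extend τ zero , refl ]
  to∘from : ∀ τ → to (from τ) ≡ τ
  to∘from (τ , [ good ]) = value-injective (removeLast-extend τ zero (isPerm-extend τ zero (proj₁ good)))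
  from∘to : ∀ e → from (to e) ≡ e
  from∘to (((σ , [ good ]) , c) , [ blocked ]) = value-injective (cong₂ _,_
    (value-injective (trans (cong (extend _) (sym σₘ≡0)) (extend-removeLast σ (proj₁ good))))
    (sym c≡max))
    where
    σₘ≡0 : lastEntry σ ≡ zero
    σₘ≡0 = recompute (lastEntry σ ≟ zero) (proj₁ blocked)
    c≡max : c ≡ fromℕ (suc m)
    c≡max = recompute (c ≟ fromℕ (suc m)) (proj₂ blocked)

blockedExtension? : Decidable (BlockedExtension {n})
blockedExtension? (σ , c) = blocked? (value σ) c

extensionSplit : ∀ {k} → Good n ↔ Fin k → FiniteSplit (Extension n) BlockedExtension (k * suc n)
extensionSplit good↔Fin = finiteSplit (↔-trans (good↔Fin ×-↔ ↔-refl) (↔-sym *↔×)) blockedExtension?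

good₀↔Fin1 : Good 0 ↔ Fin 1
good₀↔Fin1 =
  mk↔ₛ′ (λ _ → zero) (λ _ → [] , [ (λ ()) , (λ ()) ]) (λ { zero → refl }) (λ { ([] , _) → refl })

good↔Fin : ∀ n → Σ[ k ∈ ℕ ] (Good n ↔ Fin k)
good↔Fin zero = 1 , good₀↔Fin1
good↔Fin (suc n) = FiniteSplit.#out S , ↔-trans good↔unblocked (FiniteSplit.out↔ S)
  where
  S : FiniteSplit (Extension n) BlockedExtension (proj₁ (good↔Fin n) * suc n)
  S = extensionSplit (proj₂ (good↔Fin n))

a : ℕ → ℕ
a n = proj₁ (good↔Fin n)

-- a₋₁ n is a (n - 1), with the paper's convention a (-1) = 0.
a₋₁ : ℕ → ℕ
a₋₁ zero = 0
a₋₁ (suc n) = a n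

previous↔Fin : ∀ n → Previous n ↔ Fin (a₋₁ n)
previous↔Fin zero = ↔-sym 0↔⊥
previous↔Fin (suc n) = proj₂ (good↔Fin n)

-- a (suc n) is by definition the number #out of unblocked extensions.
a-step : ∀ n → a (suc n) + a₋₁ n ≡ suc n * a n
a-step n = begin
  #out + a₋₁ n   ≡⟨ cong (#out +_) (sym #in≡a₋₁) ⟩
  #out + #in     ≡⟨ ℕ.+-comm #out #in ⟩
  #in + #out     ≡⟨ #in+#out≡N ⟩
  a n * suc n    ≡⟨ ℕ.*-comm (a n) (suc n) ⟩
  suc n * a n    ∎
  where
  open ≡-Reasoning
  open FiniteSplit (extensionSplit (proj₂ (good↔Fin n)))
  #in≡a₋₁ : #in ≡ a₋₁ n
  #in≡a₋₁ = ↔⇒≡ (↔-trans (↔-sym in↔) (↔-trans blocked↔previous (previous↔Fin n)))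

avoiders↔good : ∀ n → [ v ∈ Vec (Fin n) n ∣ IsPerm v × Avoids v p ] ↔ Good n
avoiders↔good n = refinement-⇔ (λ {v} → mk⇔
  (λ (inj , avoids) → inj , avoids⇒ascentCondition v avoids)
  (λ (inj , ac) → inj , ascentCondition⇒avoids v inj ac))

proposition4p17 :
    ((n : ℕ) (v : Vec (Fin n) n) → IsPerm v → (Avoids v p ⇔ AscentCondition v))
    × Σ (ℕ → ℕ) (λ a →
        ((n : ℕ) → ([ v ∈ Vec (Fin n) n ∣ IsPerm v × Avoids v p ]) ↔ Fin (a n))
        × a 0 ≡ 1
        × a 1 ≡ 1 * a 0
        × ((n : ℕ) → a (suc (suc n)) + a n ≡ suc (suc n) * a (suc n)))
proposition4p17 =
  (λ n → avoids⇔ascentCondition) ,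
  a ,
  (λ n → ↔-trans (avoiders↔good n) (proj₂ (good↔Fin n))) ,
  refl ,
  trans (sym (ℕ.+-identityʳ (a 1))) (a-step 0) ,
  a-step ∘ suc
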